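{- Let $\mathcal{S}\subseteq\{0,1\}^n$ be a set of vectors such that for every $i\in[n]$ there exist $v,w\in\mathcal{S}$ with $v_i=1$ and $w_i=0$. A vector $v\in\{0,1\}^n$ belongs to $Cl_{S_{10}}(\mathcal{S})$ if and only if (1) there exists $w\in\mathcal{S}$ with $\mathbb{1}(v)\subseteq\mathbb{1}(w)$, and (2) for all $(k,i)\in\mathbb{1}(v)\times\mathbb{0}(v)$ there exists $w\in\mathcal{S}$ with $(w_k,w_i)=(1,0)$.
   Context: For $v\in\{0,1\}^n$, $\mathbb{1}(v)=\{i\mid v_i=1\}$ and $\mathbb{0}(v)=\{i\mid v_i=0\}$. Boolean operations act on vectors coordinate-wise. $S_{10}$ is the clone generated by the ternary operation $x\wedge(y\vee z)$, and $Cl_{S_{10}}(\mathcal{S})$ is the smallest set of vectors containing $\mathcal{S}$ and closed under $(x,y,z)\mapsto x\wedge(y\vee z)$ (applied coordinate-wise). -}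

module Defs where

open import Data.Bool using (Bool; true; false; _∧_; _∨_)
open import Data.Fin using (Fin)
open import Data.Nat using (ℕ)
open import Data.Vec using (Vec; lookup; zipWith)
open import Data.Product using (∃-syntax; _×_)
open import Relation.Binary.PropositionalEquality using (_≡_)
open import Level using (Level; _⊔_; suc)

BVec : ℕ → Set
BVec n = Vec Bool n

-- the generating operation of S10: x ∧ (y ∨ z), applied coordinate-wise
s10opV : ∀ {n} → BVec n → BVec n → BVec n → BVec n
s10opV x y z = zipWith _∧_ x (zipWith _∨_ y z)

OnesSubset : ∀ {n} → BVec n → BVec n → Set
OnesSubset {n} v w = (i : Fin n) → lookup v i ≡ true → lookup w i ≡ true

data Cl {ℓ} {n : ℕ} (S : BVec n → Set ℓ) : BVec n → Set ℓ where
  base : ∀ {v} → S v → Cl S v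
  step : ∀ {x y z} → Cl S x → Cl S y → Cl S z → Cl S (s10opV x y z)

module Submission where

-- The conditions are necessary because x ∧ (y ∨ z) lies below x, and a pair (k , i) separated by
-- x ∧ (y ∨ z) is already separated by one of x, y, z.  Conversely, fix w ∈ 𝒮 with 𝟙(v) ⊆ 𝟙(w).
-- Meets x ∧ y = x ∧ (y ∨ y) of w with the separating vectors give, for each k ∈ 𝟙(v), a vector
-- t_k ⊆ v of the closure containing k, and (by the hypothesis on 𝒮) the zero vector.  Starting
-- from zero, the joins a ↦ w ∧ (t_k ∨ a) stay below v and end at v.

open import Defs
open import Data.Bool using (true; false; _∧_; _∨_; _≟_)
open import Data.Bool.Properties using (∧-conicalˡ; ∧-conicalʳ; ∧-zeroʳ; ∨-idem; ∨-zeroʳ)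
open import Data.Empty using (⊥; ⊥-elim)
open import Data.Fin using (Fin)
open import Data.Nat using (ℕ)
open import Data.Vec using (lookup; zipWith)
open import Data.Vec.Properties using (lookup-zipWith)
open import Data.Vec.Relation.Binary.Pointwise.Extensional using (ext; Pointwise-≡⇒≡)
open import Data.List using (List; []; _∷_; allFin)
open import Data.List.Membership.Propositional using (_∈_)
open import Data.List.Membership.Propositional.Properties using (∈-allFin)
open import Data.List.Relation.Unary.Any using (here; there)
open import Data.Product using (∃-syntax; _×_; _,_; proj₂)
open import Data.Sum using (_⊎_; inj₁; inj₂)
open import Data.Unit using (⊤; tt)
open import Relation.Nullary using (yes; no; contradiction)
open import Relation.Unary using (Decidable)
open import Relation.Binary.PropositionalEquality using (_≡_; refl; sym; trans; cong; cong₂; subst)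
open import Function using (_∘_)
open import Function.Bundles using (_⇔_; mk⇔)

private
  variable
    n : ℕ

∨≡true⇒ : ∀ a b → a ∨ b ≡ true → a ≡ true ⊎ b ≡ true
∨≡true⇒ true  _ _ = inj₁ refl
∨≡true⇒ false _ e = inj₂ e

≡true⇔⇒≡ : ∀ {a b} → (a ≡ true → b ≡ true) → (b ≡ true → a ≡ true) → a ≡ b
≡true⇔⇒≡ {true}  a⇒b _ = sym (a⇒b refl)
≡true⇔⇒≡ {false} {false} _ _ = refl
≡true⇔⇒≡ {false} {true} _ b⇒a = b⇒a refl

true≢false : ∀ {b} → b ≡ true → b ≡ false → ⊥
true≢false refl ()

OnesSubset-antisym : {v w : BVec n} → OnesSubset v w → OnesSubset w v → v ≡ w
OnesSubset-antisym v⊆w w⊆v = Pointwise-≡⇒≡ (ext λ i → ≡true⇔⇒≡ (v⊆w i) (w⊆v i))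

zeros⇒OnesSubset : (t v : BVec n) → (∀ i → lookup v i ≡ false → lookup t i ≡ false) →
                   OnesSubset t v
zeros⇒OnesSubset t v zeros i tᵢ with lookup v i in vᵢ
... | true  = refl
... | false = ⊥-elim (true≢false tᵢ (zeros i vᵢ))

Separates : Fin n → Fin n → BVec n → Set
Separates k i w = lookup w k ≡ true × lookup w i ≡ false

lookup-s10opV : (x y z : BVec n) (i : Fin n) →
                lookup (s10opV x y z) i ≡ lookup x i ∧ (lookup y i ∨ lookup z i)
lookup-s10opV x y z i = trans (lookup-zipWith _∧_ i x (zipWith _∨_ y z))
                              (cong (lookup x i ∧_) (lookup-zipWith _∨_ i y z))

lookup-meet : (x y : BVec n) (i : Fin n) → lookup (s10opV x y y) i ≡ lookup x i ∧ lookup y i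
lookup-meet x y i = trans (lookup-s10opV x y y i) (cong (lookup x i ∧_) (∨-idem (lookup y i)))

s10opV-⊆ : (x y z : BVec n) → OnesSubset (s10opV x y z) x
s10opV-⊆ x y z i e = ∧-conicalˡ _ _ (trans (sym (lookup-s10opV x y z i)) e)

meet-falseˡ : (x y : BVec n) {i : Fin n} →
              lookup x i ≡ false → lookup (s10opV x y y) i ≡ false
meet-falseˡ x y {i} xᵢ = trans (lookup-meet x y i) (cong (_∧ lookup y i) xᵢ)

meet-falseʳ : (x y : BVec n) {i : Fin n} →
              lookup y i ≡ false → lookup (s10opV x y y) i ≡ false
meet-falseʳ x y {i} yᵢ = trans (lookup-meet x y i)
                                (trans (cong (lookup x i ∧_) yᵢ) (∧-zeroʳ (lookup x i)))

meet-true : (x y : BVec n) {i : Fin n} →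
            lookup x i ≡ true → lookup y i ≡ true → lookup (s10opV x y y) i ≡ true
meet-true x y {i} xᵢ yᵢ = trans (lookup-meet x y i) (cong₂ _∧_ xᵢ yᵢ)

s10opV-⊆-∨ : (x y z : BVec n) {v : BVec n} → OnesSubset y v → OnesSubset z v →
             OnesSubset (s10opV x y z) v
s10opV-⊆-∨ x y z y⊆v z⊆v i e
  with ∨≡true⇒ _ _ (∧-conicalʳ _ _ (trans (sym (lookup-s10opV x y z i)) e))
... | inj₁ yᵢ = y⊆v i yᵢ
... | inj₂ zᵢ = z⊆v i zᵢ

s10opV-true : (x y z : BVec n) {i : Fin n} → lookup x i ≡ true →
              lookup y i ≡ true ⊎ lookup z i ≡ true → lookup (s10opV x y z) i ≡ true
s10opV-true x y z {i} xᵢ (inj₁ yᵢ) =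
  trans (lookup-s10opV x y z i) (cong₂ _∧_ xᵢ (cong (_∨ lookup z i) yᵢ))
s10opV-true x y z {i} xᵢ (inj₂ zᵢ) =
  trans (lookup-s10opV x y z i) (cong₂ _∧_ xᵢ (trans (cong (lookup y i ∨_) zᵢ) (∨-zeroʳ _)))

∧∨-separates : ∀ a b c a′ b′ c′ → a ∧ (b ∨ c) ≡ true → a′ ∧ (b′ ∨ c′) ≡ false →
               (a ≡ true × a′ ≡ false) ⊎ (b ≡ true × b′ ≡ false) ⊎ (c ≡ true × c′ ≡ false)
∧∨-separates true  b     c     false b′    c′    _  _  = inj₁ (refl , refl)
∧∨-separates true  true  c     true  false false _  _  = inj₂ (inj₁ (refl , refl))
∧∨-separates true  false true  true  false false _  _  = inj₂ (inj₂ (refl , refl))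
∧∨-separates true  false false true  b′    c′    () _
∧∨-separates true  b     c     true  true  c′    _  ()
∧∨-separates true  b     c     true  false true  _  ()
∧∨-separates false b     c     a′    b′    c′    () _

s10opV-separates : (x y z : BVec n) {k i : Fin n} → Separates k i (s10opV x y z) →
                   Separates k i x ⊎ Separates k i y ⊎ Separates k i z
s10opV-separates x y z {k} {i} (rₖ , rᵢ) =
  ∧∨-separates _ _ _ _ _ _ (trans (sym (lookup-s10opV x y z k)) rₖ)
                           (trans (sym (lookup-s10opV x y z i)) rᵢ)

module Closure (S : BVec n → Set) where

  Covered : BVec n → Set
  Covered v = ∃[ w ] (S w × OnesSubset v w)

  Separated : BVec n → Set
  Separated v = (k i : Fin n) → lookup v k ≡ true → lookup v i ≡ false → ∃[ w ] (S w × Separates k i w)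

  Cl⇒Covered : ∀ {v} → Cl S v → Covered v
  Cl⇒Covered (base {v} s) = v , s , λ _ e → e
  Cl⇒Covered (step {x} {y} {z} cx _ _) with Cl⇒Covered cx
  ... | w , s , x⊆w = w , s , λ i e → x⊆w i (s10opV-⊆ x y z i e)

  Cl⇒Separated : ∀ {v} → Cl S v → Separated v
  Cl⇒Separated (base {v} s) k i vₖ vᵢ = v , s , vₖ , vᵢ
  Cl⇒Separated (step {x} {y} {z} cx cy cz) k i rₖ rᵢ with s10opV-separates x y z (rₖ , rᵢ)
  ... | inj₁ (xₖ , xᵢ)        = Cl⇒Separated cx k i xₖ xᵢ
  ... | inj₂ (inj₁ (yₖ , yᵢ)) = Cl⇒Separated cy k i yₖ yᵢ
  ... | inj₂ (inj₂ (zₖ , zᵢ)) = Cl⇒Separated cz k i zₖ zᵢ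

  Cl-clear : (Keep Clear : Fin n → Set) → Decidable Clear →
    (∀ i → Clear i → ∃[ u ] (Cl S u × lookup u i ≡ false × (∀ j → Keep j → lookup u j ≡ true))) →
    ∀ {x} → Cl S x →
    ∃[ y ] (Cl S y × OnesSubset y x × (∀ j → Keep j → lookup x j ≡ true → lookup y j ≡ true)
                   × (∀ i → Clear i → lookup y i ≡ false))
  Cl-clear Keep Clear clear? clearer {x} cx with clearAll (allFin n)
    where
    clearAll : (L : List (Fin n)) →
      ∃[ y ] (Cl S y × OnesSubset y x × (∀ j → Keep j → lookup x j ≡ true → lookup y j ≡ true)
                     × (∀ i → i ∈ L → Clear i → lookup y i ≡ false))
    clearAll [] = x , cx , (λ _ e → e) , (λ _ _ e → e) , λ _ ()
    clearAll (l ∷ L) with clearAll L | clear? l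
    ... | y , cy , y⊆x , keeps , clears | no ¬clearₗ = y , cy , y⊆x , keeps , λ where
      i (here refl) clearᵢ → contradiction clearᵢ ¬clearₗ
      i (there i∈L)        → clears i i∈L
    ... | y , cy , y⊆x , keeps , clears | yes clearₗ with clearer l clearₗ
    ... | u , cu , uₗ , u-keeps = s10opV y u u , step cy cu cu ,
      (λ i e → y⊆x i (s10opV-⊆ y u u i e)) ,
      (λ j keepⱼ xⱼ → meet-true y u (keeps j keepⱼ xⱼ) (u-keeps j keepⱼ)) , λ where
        i (here refl) _      → meet-falseʳ y u uₗ
        i (there i∈L) clearᵢ → meet-falseˡ y u (clears i i∈L clearᵢ)
  ... | y , cy , y⊆x , keeps , clears = y , cy , y⊆x , keeps , λ i → clears i (∈-allFin i)

  Cl-join-atoms : ∀ {w z} v → Cl S w → OnesSubset v w → Cl S z → OnesSubset z v →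
    (∀ k → lookup v k ≡ true → ∃[ t ] (Cl S t × lookup t k ≡ true × OnesSubset t v)) →
    Cl S v
  Cl-join-atoms {w} {z} v cw v⊆w cz z⊆v atom with joinAll (allFin n)
    where
    joinAll : (L : List (Fin n)) →
      ∃[ a ] (Cl S a × OnesSubset a v × (∀ k → k ∈ L → lookup v k ≡ true → lookup a k ≡ true))
    joinAll [] = z , cz , z⊆v , λ _ ()
    joinAll (l ∷ L) with joinAll L | lookup v l in vₗ
    ... | a , ca , a⊆v , covers | false = a , ca , a⊆v , λ where
      k (here refl) vₖ → ⊥-elim (true≢false vₖ vₗ)
      k (there k∈L)    → covers k k∈L
    ... | a , ca , a⊆v , covers | true with atom l vₗ
    ... | t , ct , tₗ , t⊆v = s10opV w t a , step cw ct ca , s10opV-⊆-∨ w t a {v} t⊆v a⊆v , λ where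
      k (here refl) vₖ → s10opV-true w t a (v⊆w k vₖ) (inj₁ tₗ)
      k (there k∈L) vₖ → s10opV-true w t a (v⊆w k vₖ) (inj₂ (covers k k∈L vₖ))
  ... | a , ca , a⊆v , covers =
    subst (Cl S) (OnesSubset-antisym a⊆v (λ k → covers k (∈-allFin k))) ca

  Cl-zero : (∀ i → ∃[ u ] (S u × lookup u i ≡ false)) →
            ∀ {x} → Cl S x → ∃[ z ] (Cl S z × ∀ i → lookup z i ≡ false)
  Cl-zero zeros cx
    with Cl-clear (λ _ → ⊥) (λ _ → ⊤) (λ _ → yes tt)
                  (λ i _ → let u , su , uᵢ = zeros i in u , base su , uᵢ , λ _ ()) cx
  ... | z , cz , _ , _ , clears = z , cz , λ i → clears i tt

  Cl-atom : ∀ {w} v → Separated v → Cl S w → OnesSubset v w →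
            ∀ k → lookup v k ≡ true → ∃[ t ] (Cl S t × lookup t k ≡ true × OnesSubset t v)
  Cl-atom v separated cw v⊆w k vₖ
    with Cl-clear (_≡ k) (λ i → lookup v i ≡ false) (λ i → lookup v i ≟ false)
                  (λ i vᵢ → let u , su , uₖ , uᵢ = separated k i vₖ vᵢ
                            in u , base su , uᵢ , λ { _ refl → uₖ }) cw
  ... | t , ct , _ , keeps , clears =
    t , ct , keeps k refl (v⊆w k vₖ) , zeros⇒OnesSubset t v clears

  Covered×Separated⇒Cl : (∀ i → ∃[ u ] (S u × lookup u i ≡ false)) →
                         ∀ {v} → Covered v → Separated v → Cl S v
  Covered×Separated⇒Cl zeros {v} (w , sw , v⊆w) separated with Cl-zero zeros (base sw)
  ... | z , cz , z≡0 = Cl-join-atoms v (base sw) v⊆w cz (zeros⇒OnesSubset z v (λ i _ → z≡0 i))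
                                    (Cl-atom v separated (base sw) v⊆w)

theorem5 : (n : ℕ) (S : BVec n → Set) →
    ((i : Fin n) → (∃[ v ] (S v × lookup v i ≡ true)) × (∃[ w ] (S w × lookup w i ≡ false))) →
    (v : BVec n) →
    Cl S v ⇔
      ((∃[ w ] (S w × OnesSubset v w)) ×
       ((k i : Fin n) → lookup v k ≡ true → lookup v i ≡ false →
         ∃[ w ] (S w × lookup w k ≡ true × lookup w i ≡ false)))
theorem5 n S hyp v =
  mk⇔ (λ cv → Cl⇒Covered cv , Cl⇒Separated cv)
      (λ (covered , separated) → Covered×Separated⇒Cl (proj₂ ∘ hyp) covered separated)
  where open Closure S
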